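{- Let $\lambda$ be a nonzero real number and let $(a_n(\lambda))_{n\ge0}$ be any sequence of real numbers. Define the degenerate B-algorithm matrix $(a_{n,m}(\lambda))_{n,m\ge0}$ by $a_{0,m}(\lambda)=a_m(\lambda)$ for $m\ge0$ and \[ a_{n,m}(\lambda)=\big(m-(n-1)\lambda\big)a_{n-1,m}(\lambda)-(m+1)a_{n-1,m+1}(\lambda),\qquad n\ge1,\ m\ge0. \] Then for every integer $n\ge0$, \[ a_{n,0}(\lambda)=\sum_{k=0}^{n}(-1)^{k}k!\,{n \brace k}_{\lambda}\,a_{0,k}(\lambda). \]
   Context: For $n\ge0$ set $(x)_{0,\lambda}=1$, $(x)_{n,\lambda}=x(x-\lambda)\cdots(x-(n-1)\lambda)$ for $n\ge1$, and $(x)_0=1$, $(x)_n=x(x-1)\cdots(x-n+1)$ for $n\ge1$. The degenerate Stirling numbers of the second kind ${n \brace k}_{\lambda}$ are defined by $(x)_{n,\lambda}=\sum_{k=0}^{n}{n \brace k}_{\lambda}(x)_{k}$ for $n\ge0$. -}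

module Defs where

open import Algebra.Bundles using (CommutativeRing)
open import Data.Nat using (ℕ; zero; suc)
open import Data.Nat using (_!)

module Over {c ℓ} (R : CommutativeRing c ℓ) where
  open CommutativeRing R public using (Carrier; _≈_; _+_; _*_; -_; _-_; 0#; 1#)

  natR : ℕ → Carrier
  natR zero    = 0#
  natR (suc n) = 1# + natR n

  signPow : ℕ → Carrier
  signPow zero    = 1#
  signPow (suc k) = - 1# * signPow k

  sumTo : ℕ → (ℕ → Carrier) → Carrier
  sumTo zero    f = f 0
  sumTo (suc n) f = sumTo n f + f (suc n)

  -- Polynomials in x over R, as coefficient sequences: p j = coefficient of x^j.
  Poly : Set c
  Poly = ℕ → Carrier

  one : Poly
  one zero    = 1#
  one (suc j) = 0#

  -- p ↦ (x - a) · p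
  mulXminus : Carrier → Poly → Poly
  mulXminus a p zero    = - (a * p zero)
  mulXminus a p (suc j) = p j - a * p (suc j)

  -- degenerate falling factorial (x)_{n,λ} = x (x - λ) ⋯ (x - (n-1)λ)
  degFall : Carrier → ℕ → Poly
  degFall lam zero    = one
  degFall lam (suc n) = mulXminus (natR n * lam) (degFall lam n)

  fall : ℕ → Poly
  fall zero    = one
  fall (suc n) = mulXminus (natR n) (fall n)

  -- S n k are the degenerate Stirling numbers of the second kind {n brace k}_λ, i.e.
  -- (x)_{n,λ} = Σ_{k=0}^{n} S n k (x)_k as polynomials in x (coefficientwise), for all n.
  IsDegStirling2 : Carrier → (ℕ → ℕ → Carrier) → Set ℓ
  IsDegStirling2 lam S =
    (n j : ℕ) → degFall lam n j ≈ sumTo n (λ k → S n k * fall k j)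

  bMatrix : Carrier → (ℕ → Carrier) → ℕ → ℕ → Carrier
  bMatrix lam a zero    m = a m
  bMatrix lam a (suc n) m =
    (natR m - natR n * lam) * bMatrix lam a n m
      - natR (suc m) * bMatrix lam a n (suc m)

{-# OPTIONS --safe #-}
-- Read a sequence h as the power series Σ h m tᵐ. The B-algorithm step
-- h ↦ m h m − (m+1) h (m+1) is the operator θ = (t − 1) d/dt, so row n of the matrix
-- is (θ)_{n,λ} = Σ_k {n brace k}_λ (θ)_k applied to row 0. The Leibniz rule
-- ∂ (t − 1) = 1 + (t − 1) ∂ gives (θ)_k = (t − 1)ᵏ ∂ᵏ, and the constant term of
-- (t − 1)ᵏ ∂ᵏ a is (−1)ᵏ k! a_k.
module Submission where

open import Defs
open import Algebra.Bundles using (CommutativeRing)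
open import Data.Nat using (ℕ; zero; suc)
open import Data.Nat using (_!)
open import Relation.Nullary using (¬_)

import Data.Nat as ℕ
open import Data.Nat using (_≤_; _<_; _≤′_; ≤′-refl; ≤′-step; s≤s)
open import Data.Nat.Properties using (≤-refl; m≤n⇒m≤1+n; ≤⇒≤′; ≤′⇒≤)
open import Relation.Binary.PropositionalEquality as ≡ using (_≡_)
import Algebra.Properties.AbelianGroup as AbelianGroupProperties
import Algebra.Properties.CommutativeSemigroup as CommutativeSemigroupProperties
import Algebra.Properties.Ring as RingProperties
import Algebra.Properties.Semiring.Mult as SemiringMultProperties
import Function.Endo.Propositional as Endo
import Relation.Binary.Reasoning.Setoid as SetoidReasoning

module BAlgorithm {c ℓ} (R : CommutativeRing c ℓ) where
  open Over R
  open CommutativeRing R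
    using ( refl; sym; trans; setoid; ring; semiring; +-abelianGroup
          ; +-commutativeSemigroup; *-commutativeSemigroup
          ; +-cong; +-congˡ; +-congʳ; *-congˡ; *-congʳ; -‿cong; -‿inverseʳ
          ; +-identityˡ; +-identityʳ; +-assoc; zeroˡ; zeroʳ; *-identityˡ; *-assoc
          ; distribˡ; distribʳ )
  open AbelianGroupProperties +-abelianGroup using (xyx⁻¹≈y; ⁻¹-∙-comm)
  open CommutativeSemigroupProperties +-commutativeSemigroup
    using (interchange; xy∙z≈xz∙y) renaming (x∙yz≈y∙xz to x+yz≈y+xz)
  open CommutativeSemigroupProperties *-commutativeSemigroup using (x∙yz≈y∙xz; x∙yz≈yx∙z)
  open RingProperties ring using (-‿distribˡ-*; -‿distribʳ-*; x[y-z]≈xy-xz; [y-z]x≈yx-zx)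
  open SemiringMultProperties semiring using (_×_; ×1-homo-*)
  open SetoidReasoning setoid

  1+x*y≈y+x*y : ∀ x y → (1# + x) * y ≈ y + x * y
  1+x*y≈y+x*y x y = trans (distribʳ y 1# x) (+-congʳ (*-identityˡ y))

  -‿distribˡ-*-+ : ∀ x y z → - (x * (y + z)) ≈ - (x * y) + - (x * z)
  -‿distribˡ-*-+ x y z = trans (-‿cong (distribˡ x y z)) (sym (⁻¹-∙-comm _ _))

  natR-1 : natR 1 ≈ 1#
  natR-1 = +-identityʳ 1#

  natR≡×1# : ∀ n → natR n ≡ n × 1#
  natR≡×1# zero    = ≡.refl
  natR≡×1# (suc n) = ≡.cong (1# +_) (natR≡×1# n)

  natR-homo-* : ∀ m n → natR (m ℕ.* n) ≈ natR m * natR n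
  natR-homo-* m n
    rewrite natR≡×1# (m ℕ.* n) | natR≡×1# m | natR≡×1# n = ×1-homo-* m n

  sumTo-cong : ∀ n {f g : ℕ → Carrier} → (∀ k → f k ≈ g k) → sumTo n f ≈ sumTo n g
  sumTo-cong zero    f≈g = f≈g 0
  sumTo-cong (suc n) f≈g = +-cong (sumTo-cong n f≈g) (f≈g (suc n))

  sumTo-cong-≤ : ∀ n {f g : ℕ → Carrier} → (∀ k → k ≤ n → f k ≈ g k) → sumTo n f ≈ sumTo n g
  sumTo-cong-≤ zero    f≈g = f≈g 0 ≤-refl
  sumTo-cong-≤ (suc n) f≈g =
    +-cong (sumTo-cong-≤ n (λ k k≤n → f≈g k (m≤n⇒m≤1+n k≤n))) (f≈g (suc n) ≤-refl)

  sumTo-distrib-+ : ∀ n (f g : ℕ → Carrier) →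
                    sumTo n (λ k → f k + g k) ≈ sumTo n f + sumTo n g
  sumTo-distrib-+ zero    f g = refl
  sumTo-distrib-+ (suc n) f g = trans (+-congʳ (sumTo-distrib-+ n f g)) (interchange _ _ _ _)

  *-distribˡ-sumTo : ∀ n x (f : ℕ → Carrier) → x * sumTo n f ≈ sumTo n (λ k → x * f k)
  *-distribˡ-sumTo zero    x f = refl
  *-distribˡ-sumTo (suc n) x f = trans (distribˡ x _ _) (+-congʳ (*-distribˡ-sumTo n x f))

  *-distribʳ-sumTo : ∀ n x (f : ℕ → Carrier) → sumTo n f * x ≈ sumTo n (λ k → f k * x)
  *-distribʳ-sumTo zero    x f = refl
  *-distribʳ-sumTo (suc n) x f = trans (distribʳ x _ _) (+-congʳ (*-distribʳ-sumTo n x f))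

  sumTo-comm : ∀ m n (F : ℕ → ℕ → Carrier) →
               sumTo m (λ j → sumTo n (F j)) ≈ sumTo n (λ k → sumTo m (λ j → F j k))
  sumTo-comm zero    n F = refl
  sumTo-comm (suc m) n F = trans (+-congʳ (sumTo-comm m n F))
    (sym (sumTo-distrib-+ n (λ k → sumTo m (λ j → F j k)) (F (suc m))))

  sumTo-suc : ∀ n (f : ℕ → Carrier) → sumTo (suc n) f ≈ f 0 + sumTo n (λ k → f (suc k))
  sumTo-suc zero    f = refl
  sumTo-suc (suc n) f = trans (+-congʳ (sumTo-suc n f)) (+-assoc _ _ _)

  sumTo-distrib-sub-* : ∀ n x (f g : ℕ → Carrier) →
                        sumTo n (λ k → f k - x * g k) ≈ sumTo n f - x * sumTo n g
  sumTo-distrib-sub-* n x f g = begin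
      sumTo n (λ k → f k - x * g k)
    ≈⟨ sumTo-cong n (λ k → +-congˡ (-‿distribˡ-* x (g k))) ⟩
      sumTo n (λ k → f k + - x * g k)
    ≈⟨ sumTo-distrib-+ n f _ ⟩
      sumTo n f + sumTo n (λ k → - x * g k)
    ≈⟨ +-congˡ (*-distribˡ-sumTo n (- x) g) ⟨
      sumTo n f + - x * sumTo n g
    ≈⟨ +-congˡ (-‿distribˡ-* x _) ⟨
      sumTo n f - x * sumTo n g
    ∎

  sumTo-vanishing : ∀ {k n} (f : ℕ → Carrier) → (∀ j → k < j → f j ≈ 0#) → k ≤ n →
                    sumTo n f ≈ sumTo k f
  sumTo-vanishing {k} f f≈0 k≤n = go (≤⇒≤′ k≤n)
    where
    go : ∀ {n} → k ≤′ n → sumTo n f ≈ sumTo k f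
    go ≤′-refl          = refl
    go (≤′-step {n} k≤n) = trans (+-cong (go k≤n) (f≈0 (suc n) (s≤s (≤′⇒≤ k≤n)))) (+-identityʳ _)

  DegreeAtMost : ℕ → Poly → Set ℓ
  DegreeAtMost d p = ∀ j → d < j → p j ≈ 0#

  one-degree : DegreeAtMost 0 one
  one-degree (suc j) _ = refl

  mulXminus-degree : ∀ {d} x {p} → DegreeAtMost d p → DegreeAtMost (suc d) (mulXminus x p)
  mulXminus-degree x {p} deg (suc j) (s≤s d<j) = begin
      p j - x * p (suc j)
    ≈⟨ +-cong (deg j d<j) (-‿cong (trans (*-congˡ (deg (suc j) (m≤n⇒m≤1+n d<j))) (zeroʳ x))) ⟩
      0# - 0#
    ≈⟨ -‿inverseʳ 0# ⟩
      0#
    ∎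

  fall-degree : ∀ k → DegreeAtMost k (fall k)
  fall-degree zero    = one-degree
  fall-degree (suc k) = mulXminus-degree (natR k) (fall-degree k)

  degFall-degree : ∀ lam k → DegreeAtMost k (degFall lam k)
  degFall-degree lam zero    = one-degree
  degFall-degree lam (suc k) = mulXminus-degree (natR k * lam) (degFall-degree lam k)

  -- mulXminus x, defined on coefficient lists of polynomials, also multiplies a
  -- power series by t − x.
  Seq : Set c
  Seq = ℕ → Carrier

  infix 4 _≋_
  _≋_ : Seq → Seq → Set ℓ
  g ≋ h = ∀ m → g m ≈ h m

  open Endo Seq using (_^_)

  ∂ : Seq → Seq
  ∂ h m = natR (suc m) * h (suc m)

  θ : Seq → Seq
  θ h m = natR m * h m - natR (suc m) * h (suc m)

  θ-minus : Carrier → Seq → Seq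
  θ-minus x h m = θ h m - x * h m

  ^-sucʳ : ∀ (F : Seq → Seq) k h → (F ^ suc k) h ≡ (F ^ k) (F h)
  ^-sucʳ F zero    h = ≡.refl
  ^-sucʳ F (suc k) h = ≡.cong F (^-sucʳ F k h)

  θ-cong : ∀ {g h} → g ≋ h → θ g ≋ θ h
  θ-cong g≋h m = +-cong (*-congˡ (g≋h m)) (-‿cong (*-congˡ (g≋h (suc m))))

  θ-minus-cong : ∀ x {g h} → g ≋ h → θ-minus x g ≋ θ-minus x h
  θ-minus-cong x g≋h m = +-cong (θ-cong g≋h m) (-‿cong (*-congˡ (g≋h m)))

  θ-+ : ∀ g h → θ (λ m → g m + h m) ≋ λ m → θ g m + θ h m
  θ-+ g h m = trans (+-cong (distribˡ _ _ _) (-‿distribˡ-*-+ _ _ _)) (interchange _ _ _ _)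

  θ-*ˡ : ∀ x h → θ (λ m → x * h m) ≋ λ m → x * θ h m
  θ-*ˡ x h m =
    trans (+-cong (x∙yz≈y∙xz _ x _) (-‿cong (x∙yz≈y∙xz _ x _))) (sym (x[y-z]≈xy-xz x _ _))

  θ-sumTo : ∀ d (F : ℕ → Seq) → θ (λ m → sumTo d (λ j → F j m)) ≋ λ m → sumTo d (λ j → θ (F j) m)
  θ-sumTo zero    F m = refl
  θ-sumTo (suc d) F m =
    trans (θ-+ (λ i → sumTo d (λ j → F j i)) (F (suc d)) m) (+-congʳ (θ-sumTo d F m))

  mulXminus-cong : ∀ x {g h} → g ≋ h → mulXminus x g ≋ mulXminus x h
  mulXminus-cong x g≋h zero    = -‿cong (*-congˡ (g≋h 0))
  mulXminus-cong x g≋h (suc m) = +-cong (g≋h m) (-‿cong (*-congˡ (g≋h (suc m))))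

  mulXminus-+ : ∀ x g h → mulXminus x (λ m → g m + h m) ≋ λ m → mulXminus x g m + mulXminus x h m
  mulXminus-+ x g h zero    = -‿distribˡ-*-+ x _ _
  mulXminus-+ x g h (suc m) = trans (+-congˡ (-‿distribˡ-*-+ x _ _)) (interchange _ _ _ _)

  mulXminus-*ˡ : ∀ x y h → mulXminus x (λ m → y * h m) ≋ λ m → y * mulXminus x h m
  mulXminus-*ˡ x y h zero    = trans (-‿cong (x∙yz≈y∙xz x y _)) (-‿distribʳ-* y _)
  mulXminus-*ˡ x y h (suc m) = trans (+-congˡ (-‿cong (x∙yz≈y∙xz x y _))) (sym (x[y-z]≈xy-xz y _ _))

  ∂-mulXminus : ∀ x h → ∂ (mulXminus x h) ≋ λ m → h m + mulXminus x (∂ h) m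
  ∂-mulXminus x h zero = begin
      (1# + 0#) * (h 0 - x * h 1)
    ≈⟨ trans (*-congʳ natR-1) (*-identityˡ _) ⟩
      h 0 - x * h 1
    ≈⟨ +-congˡ (-‿cong (*-congˡ (sym (trans (*-congʳ natR-1) (*-identityˡ _))))) ⟩
      h 0 + - (x * ((1# + 0#) * h 1))
    ∎
  ∂-mulXminus x h (suc m) = begin
      (1# + n) * (h (suc m) - x * h (suc (suc m)))
    ≈⟨ x[y-z]≈xy-xz (1# + n) _ _ ⟩
      (1# + n) * h (suc m) - (1# + n) * (x * h (suc (suc m)))
    ≈⟨ +-cong (1+x*y≈y+x*y n _) (-‿cong (x∙yz≈y∙xz _ x _)) ⟩
      (h (suc m) + n * h (suc m)) - x * ((1# + n) * h (suc (suc m)))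
    ≈⟨ +-assoc _ _ _ ⟩
      h (suc m) + (n * h (suc m) - x * ((1# + n) * h (suc (suc m))))
    ∎
    where n = natR (suc m)

  θ≋mulXminus1#∘∂ : ∀ h → θ h ≋ mulXminus 1# (∂ h)
  θ≋mulXminus1#∘∂ h zero    =
    trans (+-congʳ (zeroˡ (h 0))) (trans (+-identityˡ _) (-‿cong (sym (*-identityˡ _))))
  θ≋mulXminus1#∘∂ h (suc m) = +-congˡ (-‿cong (sym (*-identityˡ _)))

  mulXminus∘∂-mulXminus^ : ∀ x k h →
    mulXminus x (∂ ((mulXminus x ^ k) h))
      ≋ λ m → natR k * (mulXminus x ^ k) h m + (mulXminus x ^ suc k) (∂ h) m
  mulXminus∘∂-mulXminus^ x zero h m = sym (trans (+-congʳ (zeroˡ _)) (+-identityˡ _))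
  mulXminus∘∂-mulXminus^ x (suc k) h m = begin
      Mx (∂ (Mx H)) m
    ≈⟨ mulXminus-cong x (∂-mulXminus x H) m ⟩
      Mx (λ i → H i + Mx (∂ H) i) m
    ≈⟨ mulXminus-+ x H (Mx (∂ H)) m ⟩
      Mx H m + Mx (Mx (∂ H)) m
    ≈⟨ +-congˡ (mulXminus-cong x (mulXminus∘∂-mulXminus^ x k h) m) ⟩
      Mx H m + Mx (λ i → natR k * H i + H′ i) m
    ≈⟨ +-congˡ (mulXminus-+ x (λ i → natR k * H i) H′ m) ⟩
      Mx H m + (Mx (λ i → natR k * H i) m + Mx H′ m)
    ≈⟨ +-congˡ (+-congʳ (mulXminus-*ˡ x (natR k) H m)) ⟩
      Mx H m + (natR k * Mx H m + Mx H′ m)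
    ≈⟨ trans (sym (+-assoc _ _ _)) (+-congʳ (sym (1+x*y≈y+x*y (natR k) _))) ⟩
      (1# + natR k) * Mx H m + Mx H′ m
    ∎
    where
    Mx = mulXminus x
    H  = (Mx ^ k) h
    H′ = (Mx ^ suc k) (∂ h)

  θ-mulXminus1#^ : ∀ k h →
    θ ((mulXminus 1# ^ k) h)
      ≋ λ m → natR k * (mulXminus 1# ^ k) h m + (mulXminus 1# ^ suc k) (∂ h) m
  θ-mulXminus1#^ k h m =
    trans (θ≋mulXminus1#∘∂ ((mulXminus 1# ^ k) h) m) (mulXminus∘∂-mulXminus^ 1# k h m)

  mulXminus1#^-at-0 : ∀ k h → (mulXminus 1# ^ k) h 0 ≈ signPow k * h 0
  mulXminus1#^-at-0 zero    h = sym (*-identityˡ _)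
  mulXminus1#^-at-0 (suc k) h = begin
      - (1# * (mulXminus 1# ^ k) h 0)
    ≈⟨ -‿cong (*-congˡ (mulXminus1#^-at-0 k h)) ⟩
      - (1# * (signPow k * h 0))
    ≈⟨ trans (-‿distribˡ-* 1# _) (sym (*-assoc _ _ _)) ⟩
      - 1# * signPow k * h 0
    ∎

  ∂^-at-0 : ∀ k h → (∂ ^ k) h 0 ≈ natR (k !) * h k
  ∂^-at-0 zero    h = sym (trans (*-congʳ natR-1) (*-identityˡ _))
  ∂^-at-0 (suc k) h = begin
      (∂ ^ suc k) h 0
    ≡⟨ ≡.cong (λ g → g 0) (^-sucʳ ∂ k h) ⟩
      (∂ ^ k) (∂ h) 0
    ≈⟨ ∂^-at-0 k (∂ h) ⟩
      natR (k !) * (natR (suc k) * h (suc k))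
    ≈⟨ x∙yz≈yx∙z _ _ _ ⟩
      natR (suc k) * natR (k !) * h (suc k)
    ≈⟨ *-congʳ (sym (natR-homo-* (suc k) (k !))) ⟩
      natR (suc k !) * h (suc k)
    ∎

  evalθ : ℕ → Poly → Seq → Seq
  evalθ d p g m = sumTo d (λ j → p j * (θ ^ j) g m)

  evalθ-degree : ∀ {d e} p g → DegreeAtMost d p → d ≤ e → evalθ e p g ≋ evalθ d p g
  evalθ-degree p g deg d≤e m =
    sumTo-vanishing _ (λ j d<j → trans (*-congʳ (deg j d<j)) (zeroˡ _)) d≤e

  θ-evalθ : ∀ d p g → θ (evalθ d p g) ≋ λ m → sumTo d (λ j → p j * (θ ^ suc j) g m)
  θ-evalθ d p g m = trans (θ-sumTo d (λ j i → p j * (θ ^ j) g i) m)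
                          (sumTo-cong d (λ j → θ-*ˡ (p j) ((θ ^ j) g) m))

  evalθ-split : ∀ d p g → DegreeAtMost d p →
    evalθ d p g ≋ λ m → p 0 * g m + sumTo d (λ j → p (suc j) * (θ ^ suc j) g m)
  evalθ-split d p g deg m =
    trans (sym (evalθ-degree p g deg (m≤n⇒m≤1+n ≤-refl) m)) (sumTo-suc d (λ j → p j * (θ ^ j) g m))

  evalθ-mulXminus : ∀ d x p g → DegreeAtMost d p →
                    evalθ (suc d) (mulXminus x p) g ≋ θ-minus x (evalθ d p g)
  evalθ-mulXminus d x p g deg m = begin
      evalθ (suc d) (mulXminus x p) g m
    ≈⟨ sumTo-suc d (λ j → mulXminus x p j * (θ ^ j) g m) ⟩
      - (x * p 0) * g m + sumTo d (λ j → (p j - x * p (suc j)) * T j)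
    ≈⟨ +-cong (trans (sym (-‿distribˡ-* _ _)) (-‿cong (*-assoc _ _ _)))
              (sumTo-cong d (λ j → trans ([y-z]x≈yx-zx _ _ _) (+-congˡ (-‿cong (*-assoc _ _ _))))) ⟩
      - (x * (p 0 * g m)) + sumTo d (λ j → p j * T j - x * (p (suc j) * T j))
    ≈⟨ +-congˡ (sumTo-distrib-sub-* d x _ _) ⟩
      - (x * (p 0 * g m)) + (A - x * B)
    ≈⟨ trans (x+yz≈y+xz _ _ _) (+-congˡ (sym (-‿distribˡ-*-+ x _ _))) ⟩
      A - x * (p 0 * g m + B)
    ≈⟨ +-cong (sym (θ-evalθ d p g m)) (-‿cong (*-congˡ (sym (evalθ-split d p g deg m)))) ⟩
      θ-minus x (evalθ d p g) m
    ∎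
    where
    T : ℕ → Carrier
    T j = (θ ^ suc j) g m
    A B : Carrier
    A = sumTo d (λ j → p j * T j)
    B = sumTo d (λ j → p (suc j) * T j)

  evalθ-linear : ∀ d n (s : ℕ → Carrier) (q : ℕ → Poly) g m →
    evalθ d (λ j → sumTo n (λ k → s k * q k j)) g m ≈ sumTo n (λ k → s k * evalθ d (q k) g m)
  evalθ-linear d n s q g m = begin
      sumTo d (λ j → sumTo n (λ k → s k * q k j) * T j)
    ≈⟨ sumTo-cong d (λ j → trans (*-distribʳ-sumTo n (T j) _)
                                 (sumTo-cong n (λ k → *-assoc _ _ _))) ⟩
      sumTo d (λ j → sumTo n (λ k → s k * (q k j * T j)))
    ≈⟨ sumTo-comm d n _ ⟩
      sumTo n (λ k → sumTo d (λ j → s k * (q k j * T j)))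
    ≈⟨ sumTo-cong n (λ k → sym (*-distribˡ-sumTo d (s k) _)) ⟩
      sumTo n (λ k → s k * evalθ d (q k) g m)
    ∎
    where
    T : ℕ → Carrier
    T j = (θ ^ j) g m

  bMatrix-suc : ∀ lam a n → bMatrix lam a (suc n) ≋ θ-minus (natR n * lam) (bMatrix lam a n)
  bMatrix-suc lam a n m = trans (+-congʳ ([y-z]x≈yx-zx _ _ _)) (xy∙z≈xz∙y _ _ _)

  bMatrix≋evalθ-degFall : ∀ lam a n → bMatrix lam a n ≋ evalθ n (degFall lam n) a
  bMatrix≋evalθ-degFall lam a zero    m = sym (*-identityˡ _)
  bMatrix≋evalθ-degFall lam a (suc n) m = begin
      bMatrix lam a (suc n) m
    ≈⟨ bMatrix-suc lam a n m ⟩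
      θ-minus (natR n * lam) (bMatrix lam a n) m
    ≈⟨ θ-minus-cong _ (bMatrix≋evalθ-degFall lam a n) m ⟩
      θ-minus (natR n * lam) (evalθ n (degFall lam n) a) m
    ≈⟨ sym (evalθ-mulXminus n _ _ a (degFall-degree lam n) m) ⟩
      evalθ (suc n) (degFall lam (suc n)) a m
    ∎

  evalθ-fall : ∀ k g → evalθ k (fall k) g ≋ (mulXminus 1# ^ k) ((∂ ^ k) g)
  evalθ-fall zero    g m = *-identityˡ _
  evalθ-fall (suc k) g m = begin
      evalθ (suc k) (fall (suc k)) g m
    ≈⟨ evalθ-mulXminus k _ _ g (fall-degree k) m ⟩
      θ-minus (natR k) (evalθ k (fall k) g) m
    ≈⟨ θ-minus-cong _ (evalθ-fall k g) m ⟩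
      θ (G k) m - natR k * G k m
    ≈⟨ +-congʳ (θ-mulXminus1#^ k ((∂ ^ k) g) m) ⟩
      (natR k * G k m + G (suc k) m) - natR k * G k m
    ≈⟨ xyx⁻¹≈y _ _ ⟩
      G (suc k) m
    ∎
    where
    G : ℕ → Seq
    G i = (mulXminus 1# ^ i) ((∂ ^ i) g)

  evalθ-fall-at-0 : ∀ {k n} → k ≤ n → ∀ g → evalθ n (fall k) g 0 ≈ signPow k * natR (k !) * g k
  evalθ-fall-at-0 {k} {n} k≤n g = begin
      evalθ n (fall k) g 0
    ≈⟨ evalθ-degree (fall k) g (fall-degree k) k≤n 0 ⟩
      evalθ k (fall k) g 0
    ≈⟨ evalθ-fall k g 0 ⟩
      (mulXminus 1# ^ k) ((∂ ^ k) g) 0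
    ≈⟨ mulXminus1#^-at-0 k _ ⟩
      signPow k * (∂ ^ k) g 0
    ≈⟨ *-congˡ (∂^-at-0 k g) ⟩
      signPow k * (natR (k !) * g k)
    ≈⟨ sym (*-assoc _ _ _) ⟩
      signPow k * natR (k !) * g k
    ∎

theorem2p3 : ∀ {c ℓ} (R : CommutativeRing c ℓ) →
    let open Over R in
    (lam : Carrier) → ¬ (lam ≈ 0#) →
    (a : ℕ → Carrier) → (S : ℕ → ℕ → Carrier) → IsDegStirling2 lam S →
    (n : ℕ) →
    bMatrix lam a n 0 ≈ sumTo n (λ k → signPow k * natR (k !) * S n k * bMatrix lam a 0 k)
theorem2p3 R lam _ a S isStirling n = begin
    bMatrix lam a n 0
  ≈⟨ bMatrix≋evalθ-degFall lam a n 0 ⟩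
    evalθ n (degFall lam n) a 0
  ≈⟨ sumTo-cong n (λ j → *-congʳ (isStirling n j)) ⟩
    evalθ n (λ j → sumTo n (λ k → S n k * fall k j)) a 0
  ≈⟨ evalθ-linear n n (S n) fall a 0 ⟩
    sumTo n (λ k → S n k * evalθ n (fall k) a 0)
  ≈⟨ sumTo-cong-≤ n (λ k k≤n → *-congˡ (evalθ-fall-at-0 k≤n a)) ⟩
    sumTo n (λ k → S n k * (signPow k * natR (k !) * a k))
  ≈⟨ sumTo-cong n (λ k → x∙yz≈yx∙z _ _ _) ⟩
    sumTo n (λ k → signPow k * natR (k !) * S n k * a k)
  ∎
  where
  open Over R
  open BAlgorithm R
  open CommutativeRing R using (setoid; *-congˡ; *-congʳ; *-commutativeSemigroup)
  open CommutativeSemigroupProperties *-commutativeSemigroup using (x∙yz≈yx∙z)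
  open SetoidReasoning setoid
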